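{- The proof system $\mathcal{G}^c$ is weaker than the proof system $\mathcal{MG}^c$: for every set $\Gamma$ of patterns and every pattern $\varphi$, if $\Gamma\vdash_{\mathcal{G}^c}\varphi$ then $\Gamma\vdash_{\mathcal{MG}^c}\varphi$.
   Context: Fix a countably infinite set $EVar$ of element variables and a set $\Sigma$ of constant symbols containing a distinguished "definedness symbol" $\lceil\,\rceil$. Patterns are generated by $\varphi::= x\mid \sigma\mid \bot\mid \neg\varphi\mid \varphi\to\varphi\mid \varphi\wedge\varphi\mid\varphi\vee\varphi\mid \varphi\cdot\varphi\mid \forall x\varphi\mid\exists x\varphi$ ($x\in EVar$, $\sigma\in\Sigma$; $\varphi\cdot\psi$ is "application"). Abbreviations: $\varphi\leftrightarrow\psi:=(\varphi\to\psi)\wedge(\psi\to\varphi)$, $\lceil\varphi\rceil:=\lceil\,\rceil\cdot\varphi$, $\lfloor\varphi\rfloor:=\neg\lceil\neg\varphi\rceil$, $\varphi=\psi:=\lfloor\varphi\leftrightarrow\psi\rfloor$. An occurrence of $x$ in $\varphi$ is bound if it lies inside a subpattern $\forall x\psi$ or $\exists x\psi$, otherwise free; $FV(\varphi)$ is the set of variables with a free occurrence. $\mathrm{Subf}_x^y\varphi$ is the result of replacing every free occurrence of $x$ in $\varphi$ by $y$; "$x$ is free for $y$ in $\varphi$" means no free occurrence of $x$ in $\varphi$ lies inside a subpattern of the form $\forall y\psi$ or $\exists y\psi$. For a proof system $S$ and a set $\Gamma$ of patterns, $\Gamma\vdash_S\varphi$ means there is a finite sequence of patterns ending with $\varphi$,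 each an instance of an axiom of $S$, an element of $\Gamma$, or obtained from earlier members by a rule of $S$. Both systems share the propositional axioms $\varphi\vee\varphi\to\varphi$; $\varphi\to\varphi\wedge\varphi$; $\varphi\to\varphi\vee\psi$; $\varphi\wedge\psi\to\varphi$; $\varphi\vee\psi\to\psi\vee\varphi$; $\varphi\wedge\psi\to\psi\wedge\varphi$; $\bot\to\varphi$; $\varphi\vee\neg\varphi$; $\neg\varphi\to(\varphi\to\bot)$; $(\varphi\to\bot)\to\neg\varphi$; the propositional rules: from $\varphi$, $\varphi\to\psi$ infer $\psi$; from $\varphi\to\psi$, $\psi\to\chi$ infer $\varphi\to\chi$; from $\varphi\wedge\psi\to\chi$ infer $\varphi\to(\psi\to\chi)$; from $\varphi\to(\psi\to\chi)$ infer $\varphi\wedge\psi\to\chi$; from $\varphi\to\psi$ infer $\chi\vee\varphi\to\chi\vee\psi$; the application axioms $(\varphi\vee\psi)\cdot\chi\to\varphi\cdot\chi\vee\psi\cdot\chi$, $\chi\cdot(\varphi\vee\psi)\to\chi\cdot\varphi\vee\chi\cdot\psi$, and $(\exists x\varphi)\cdot\psi\to\exists x(\varphi\cdot\psi)$, $\psi\cdot(\exists x\varphi)\to\exists x(\psi\cdot\varphi)$ whenever $x$ does not occur in $\psi$; and the framing rules: from $\varphi\to\psi$ infer $\varphi\cdot\chi\to\psi\cdot\chi$ and $\chi\cdot\varphi\to\chi\cdot\psi$. $\mathcal{G}^c$ additionally has the axioms $\mathrm{Subf}_x^y\varphi\to\exists x\varphi$ and $\forall x\varphi\to\mathrm{Subf}_x^y\varphi$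 whenever $x$ is free for $y$ in $\varphi$, $\varphi\cdot\bot\to\bot$, $\bot\cdot\varphi\to\bot$, and the rules: from $\varphi\to\psi$ infer $\exists x\varphi\to\psi$ if $x\notin FV(\psi)$; from $\varphi\to\psi$ infer $\varphi\to\forall x\psi$ if $x\notin FV(\varphi)$. $\mathcal{MG}^c$ additionally has the axioms $\forall x(\varphi\to\psi)\to(\forall x\varphi\to\forall x\psi)$; $\varphi\to\forall x\varphi$ if $x$ does not occur in $\varphi$; $\exists x(x=y)$ for $y$ a variable distinct from $x$; $\exists x\varphi\to\neg\forall x\neg\varphi$; $\neg\forall x\neg\varphi\to\exists x\varphi$; $\lceil\varphi\rceil\cdot\psi\to\lceil\varphi\rceil$; $\psi\cdot\lceil\varphi\rceil\to\lceil\varphi\rceil$; $\lceil x\rceil$; $\varphi\to\lceil\varphi\rceil$; $\lceil\bot\rceil\to\bot$; and the rule: from $\varphi$ infer $\forall x\varphi$. -}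

module Defs where

open import Data.Nat using (ℕ)
open import Data.Nat.Properties using (_≟_)
open import Data.Empty using (⊥)
open import Data.Unit using (⊤)
open import Data.Product using (_×_)
open import Relation.Nullary using (¬_; yes; no)
open import Relation.Binary.PropositionalEquality using (_≡_)

EVar : Set
EVar = ℕ

module _ (S : Set) where
  infixr 5 _⇒_
  infixr 6 _∨p_
  infixr 7 _∧p_
  infixl 9 _·_
  data Pattern : Set where
    var  : EVar → Pattern
    sym  : S → Pattern
    ⊥p   : Pattern
    ¬p   : Pattern → Pattern
    _⇒_  : Pattern → Pattern → Pattern
    _∧p_ : Pattern → Pattern → Pattern
    _∨p_ : Pattern → Pattern → Pattern
    _·_  : Pattern → Pattern → Pattern
    all  : EVar → Pattern → Pattern
    ex   : EVar → Pattern → Pattern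

module _ {S : Set} where

  data FreeIn (x : EVar) : Pattern S → Set where
    fvar : FreeIn x (var x)
    fneg : ∀ {φ} → FreeIn x φ → FreeIn x (¬p φ)
    fimpl : ∀ {φ ψ} → FreeIn x φ → FreeIn x (φ ⇒ ψ)
    fimpr : ∀ {φ ψ} → FreeIn x ψ → FreeIn x (φ ⇒ ψ)
    fandl : ∀ {φ ψ} → FreeIn x φ → FreeIn x (φ ∧p ψ)
    fandr : ∀ {φ ψ} → FreeIn x ψ → FreeIn x (φ ∧p ψ)
    forl : ∀ {φ ψ} → FreeIn x φ → FreeIn x (φ ∨p ψ)
    forr : ∀ {φ ψ} → FreeIn x ψ → FreeIn x (φ ∨p ψ)
    fappl : ∀ {φ ψ} → FreeIn x φ → FreeIn x (φ · ψ)
    fappr : ∀ {φ ψ} → FreeIn x ψ → FreeIn x (φ · ψ)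
    fall : ∀ {y φ} → ¬ (y ≡ x) → FreeIn x φ → FreeIn x (all y φ)
    fex  : ∀ {y φ} → ¬ (y ≡ x) → FreeIn x φ → FreeIn x (ex y φ)

  data Occurs (x : EVar) : Pattern S → Set where
    ovar : Occurs x (var x)
    oneg : ∀ {φ} → Occurs x φ → Occurs x (¬p φ)
    oimpl : ∀ {φ ψ} → Occurs x φ → Occurs x (φ ⇒ ψ)
    oimpr : ∀ {φ ψ} → Occurs x ψ → Occurs x (φ ⇒ ψ)
    oandl : ∀ {φ ψ} → Occurs x φ → Occurs x (φ ∧p ψ)
    oandr : ∀ {φ ψ} → Occurs x ψ → Occurs x (φ ∧p ψ)
    oorl : ∀ {φ ψ} → Occurs x φ → Occurs x (φ ∨p ψ)
    oorr : ∀ {φ ψ} → Occurs x ψ → Occurs x (φ ∨p ψ)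
    oappl : ∀ {φ ψ} → Occurs x φ → Occurs x (φ · ψ)
    oappr : ∀ {φ ψ} → Occurs x ψ → Occurs x (φ · ψ)
    oallb : ∀ {φ} → Occurs x (all x φ)
    oall  : ∀ {y φ} → Occurs x φ → Occurs x (all y φ)
    oexb  : ∀ {φ} → Occurs x (ex x φ)
    oex   : ∀ {y φ} → Occurs x φ → Occurs x (ex y φ)

  Subf : EVar → EVar → Pattern S → Pattern S
  Subf x y (var z) with z ≟ x
  ... | yes _ = var y
  ... | no  _ = var z
  Subf x y (sym σ) = sym σ
  Subf x y ⊥p = ⊥p
  Subf x y (¬p φ) = ¬p (Subf x y φ)
  Subf x y (φ ⇒ ψ) = Subf x y φ ⇒ Subf x y ψ
  Subf x y (φ ∧p ψ) = Subf x y φ ∧p Subf x y ψ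
  Subf x y (φ ∨p ψ) = Subf x y φ ∨p Subf x y ψ
  Subf x y (φ · ψ) = Subf x y φ · Subf x y ψ
  Subf x y (all z φ) with z ≟ x
  ... | yes _ = all z φ
  ... | no  _ = all z (Subf x y φ)
  Subf x y (ex z φ) with z ≟ x
  ... | yes _ = ex z φ
  ... | no  _ = ex z (Subf x y φ)

  -- "x is free for y in φ": no free occurrence of x in φ lies inside
  -- a subpattern of the form ∀y ψ or ∃y ψ.
  FreeFor : EVar → EVar → Pattern S → Set
  FreeForBinder : EVar → EVar → EVar → Pattern S → Set
  FreeFor x y (var z) = ⊤
  FreeFor x y (sym σ) = ⊤
  FreeFor x y ⊥p = ⊤
  FreeFor x y (¬p φ) = FreeFor x y φ
  FreeFor x y (φ ⇒ ψ) = FreeFor x y φ × FreeFor x y ψ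
  FreeFor x y (φ ∧p ψ) = FreeFor x y φ × FreeFor x y ψ
  FreeFor x y (φ ∨p ψ) = FreeFor x y φ × FreeFor x y ψ
  FreeFor x y (φ · ψ) = FreeFor x y φ × FreeFor x y ψ
  FreeFor x y (all z φ) = FreeForBinder x y z φ
  FreeFor x y (ex z φ) = FreeForBinder x y z φ
  FreeForBinder x y z φ with z ≟ x
  ... | yes _ = ⊤                      -- x has no free occurrence here
  ... | no _ with z ≟ y
  ...   | yes _ = ¬ FreeIn x φ         -- free x would lie inside ∀y/∃y
  ...   | no _  = FreeFor x y φ

  _⇔_ : Pattern S → Pattern S → Pattern S
  φ ⇔ ψ = (φ ⇒ ψ) ∧p (ψ ⇒ φ)

  module Definedness (dfd : S) where
    ⌈_⌉ : Pattern S → Pattern S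
    ⌈ φ ⌉ = sym dfd · φ
    ⌊_⌋ : Pattern S → Pattern S
    ⌊ φ ⌋ = ¬p ⌈ ¬p φ ⌉
    _≐_ : Pattern S → Pattern S → Pattern S
    φ ≐ ψ = ⌊ φ ⇔ ψ ⌋

  data SharedAxiom : Pattern S → Set where
    ax-or-idem   : ∀ φ → SharedAxiom (φ ∨p φ ⇒ φ)
    ax-and-dup   : ∀ φ → SharedAxiom (φ ⇒ φ ∧p φ)
    ax-or-intro  : ∀ φ ψ → SharedAxiom (φ ⇒ φ ∨p ψ)
    ax-and-elim  : ∀ φ ψ → SharedAxiom (φ ∧p ψ ⇒ φ)
    ax-or-comm   : ∀ φ ψ → SharedAxiom (φ ∨p ψ ⇒ ψ ∨p φ)
    ax-and-comm  : ∀ φ ψ → SharedAxiom (φ ∧p ψ ⇒ ψ ∧p φ)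
    ax-bot       : ∀ φ → SharedAxiom (⊥p ⇒ φ)
    ax-lem       : ∀ φ → SharedAxiom (φ ∨p ¬p φ)
    ax-neg-elim  : ∀ φ → SharedAxiom (¬p φ ⇒ (φ ⇒ ⊥p))
    ax-neg-intro : ∀ φ → SharedAxiom ((φ ⇒ ⊥p) ⇒ ¬p φ)
    ax-prop-or-l : ∀ φ ψ χ → SharedAxiom ((φ ∨p ψ) · χ ⇒ φ · χ ∨p ψ · χ)
    ax-prop-or-r : ∀ φ ψ χ → SharedAxiom (χ · (φ ∨p ψ) ⇒ χ · φ ∨p χ · ψ)
    ax-prop-ex-l : ∀ x φ ψ → ¬ Occurs x ψ → SharedAxiom ((ex x φ) · ψ ⇒ ex x (φ · ψ))
    ax-prop-ex-r : ∀ x φ ψ → ¬ Occurs x ψ → SharedAxiom (ψ · (ex x φ) ⇒ ex x (ψ · φ))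

  -- Proof system G^c. Γ ⊢G φ: φ is derivable from Γ (derivation trees,
  -- equivalent to finite proof sequences).
  data _⊢G_ (Γ : Pattern S → Set) : Pattern S → Set where
    hyp    : ∀ {φ} → Γ φ → Γ ⊢G φ
    shared : ∀ {φ} → SharedAxiom φ → Γ ⊢G φ
    mp     : ∀ {φ ψ} → Γ ⊢G φ → Γ ⊢G (φ ⇒ ψ) → Γ ⊢G ψ
    syll   : ∀ {φ ψ χ} → Γ ⊢G (φ ⇒ ψ) → Γ ⊢G (ψ ⇒ χ) → Γ ⊢G (φ ⇒ χ)
    exportR : ∀ {φ ψ χ} → Γ ⊢G (φ ∧p ψ ⇒ χ) → Γ ⊢G (φ ⇒ (ψ ⇒ χ))
    importR : ∀ {φ ψ χ} → Γ ⊢G (φ ⇒ (ψ ⇒ χ)) → Γ ⊢G (φ ∧p ψ ⇒ χ)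
    expan  : ∀ {φ ψ} χ → Γ ⊢G (φ ⇒ ψ) → Γ ⊢G (χ ∨p φ ⇒ χ ∨p ψ)
    frameL : ∀ {φ ψ} χ → Γ ⊢G (φ ⇒ ψ) → Γ ⊢G (φ · χ ⇒ ψ · χ)
    frameR : ∀ {φ ψ} χ → Γ ⊢G (φ ⇒ ψ) → Γ ⊢G (χ · φ ⇒ χ · ψ)
    ax-ex-intro : ∀ x y φ → FreeFor x y φ → Γ ⊢G (Subf x y φ ⇒ ex x φ)
    ax-all-elim : ∀ x y φ → FreeFor x y φ → Γ ⊢G (all x φ ⇒ Subf x y φ)
    ax-prop-botL : ∀ φ → Γ ⊢G (φ · ⊥p ⇒ ⊥p)
    ax-prop-botR : ∀ φ → Γ ⊢G (⊥p · φ ⇒ ⊥p)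
    ex-rule  : ∀ {φ ψ} x → ¬ FreeIn x ψ → Γ ⊢G (φ ⇒ ψ) → Γ ⊢G (ex x φ ⇒ ψ)
    all-rule : ∀ {φ ψ} x → ¬ FreeIn x φ → Γ ⊢G (φ ⇒ ψ) → Γ ⊢G (φ ⇒ all x ψ)

  module _ (dfd : S) where
    open Definedness dfd

    data _⊢MG_ (Γ : Pattern S → Set) : Pattern S → Set where
      hyp    : ∀ {φ} → Γ φ → Γ ⊢MG φ
      shared : ∀ {φ} → SharedAxiom φ → Γ ⊢MG φ
      mp     : ∀ {φ ψ} → Γ ⊢MG φ → Γ ⊢MG (φ ⇒ ψ) → Γ ⊢MG ψ
      syll   : ∀ {φ ψ χ} → Γ ⊢MG (φ ⇒ ψ) → Γ ⊢MG (ψ ⇒ χ) → Γ ⊢MG (φ ⇒ χ)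
      exportR : ∀ {φ ψ χ} → Γ ⊢MG (φ ∧p ψ ⇒ χ) → Γ ⊢MG (φ ⇒ (ψ ⇒ χ))
      importR : ∀ {φ ψ χ} → Γ ⊢MG (φ ⇒ (ψ ⇒ χ)) → Γ ⊢MG (φ ∧p ψ ⇒ χ)
      expan  : ∀ {φ ψ} χ → Γ ⊢MG (φ ⇒ ψ) → Γ ⊢MG (χ ∨p φ ⇒ χ ∨p ψ)
      frameL : ∀ {φ ψ} χ → Γ ⊢MG (φ ⇒ ψ) → Γ ⊢MG (φ · χ ⇒ ψ · χ)
      frameR : ∀ {φ ψ} χ → Γ ⊢MG (φ ⇒ ψ) → Γ ⊢MG (χ · φ ⇒ χ · ψ)
      ax-K      : ∀ x φ ψ → Γ ⊢MG (all x (φ ⇒ ψ) ⇒ (all x φ ⇒ all x ψ))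
      ax-vacall : ∀ x φ → ¬ Occurs x φ → Γ ⊢MG (φ ⇒ all x φ)
      ax-exeq   : ∀ x y → ¬ (x ≡ y) → Γ ⊢MG ex x (var x ≐ var y)
      ax-ex-dual1 : ∀ x φ → Γ ⊢MG (ex x φ ⇒ ¬p (all x (¬p φ)))
      ax-ex-dual2 : ∀ x φ → Γ ⊢MG (¬p (all x (¬p φ)) ⇒ ex x φ)
      ax-defL   : ∀ φ ψ → Γ ⊢MG (⌈ φ ⌉ · ψ ⇒ ⌈ φ ⌉)
      ax-defR   : ∀ φ ψ → Γ ⊢MG (ψ · ⌈ φ ⌉ ⇒ ⌈ φ ⌉)
      ax-defvar : ∀ x → Γ ⊢MG ⌈ var x ⌉
      ax-defin  : ∀ φ → Γ ⊢MG (φ ⇒ ⌈ φ ⌉)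
      ax-defbot : Γ ⊢MG (⌈ ⊥p ⌉ ⇒ ⊥p)
      gen       : ∀ {φ} x → Γ ⊢MG φ → Γ ⊢MG all x φ

{-# OPTIONS --safe #-}
module Submission where

open import Defs
open import Data.Nat using (ℕ; suc; _⊔_; _≤_; s≤s)
open import Data.Nat.Properties using (_≟_; m≤m⊔n; m≤n⊔m; ≤-refl; ≤-trans; 1+n≰n; <⇒≢)
open import Data.Empty using (⊥-elim)
open import Data.Unit using (tt)
open import Data.Product using (_×_; _,_; proj₁)
open import Data.Sum using (_⊎_; inj₁; inj₂)
import Data.Sum as Sum
open import Function using (_∘_)
open import Relation.Nullary using (¬_; yes; no)
open import Relation.Binary.PropositionalEquality as ≡ using (_≡_; _≢_; refl; cong; cong₂; subst)

-- ⊥ propagates through application in MG^c because ⊥ ⇒ ⌈⊥⌉, ⌈⊥⌉ absorbs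
-- applications and ⌈⊥⌉ ⇒ ⊥.
-- Instantiation ∀x φ ⇒ φ[y/x] comes from ∃x (x ≐ y) and the substitution
-- property x ≐ y ⇒ (φ ⇔ φ[y/x]), proved by induction on φ (at applications
-- because a floor is a predicate: its negation, a ceiling, absorbs
-- applications); this yields ∀x φ ⇒ ∃x φ[y/x], whose ∃x is vacuous.
-- MG^c only drops quantifiers over variables that do not occur at all, so
-- bound occurrences of x are first α-renamed away; α-renaming is itself an
-- instance of the same argument with a fresh variable.

module _ {S : Set} where

  data BindsIn (x : EVar) : Pattern S → Set where
    bneg  : ∀ {φ} → BindsIn x φ → BindsIn x (¬p φ)
    bimpl : ∀ {φ ψ} → BindsIn x φ → BindsIn x (φ ⇒ ψ)
    bimpr : ∀ {φ ψ} → BindsIn x ψ → BindsIn x (φ ⇒ ψ)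
    bandl : ∀ {φ ψ} → BindsIn x φ → BindsIn x (φ ∧p ψ)
    bandr : ∀ {φ ψ} → BindsIn x ψ → BindsIn x (φ ∧p ψ)
    borl  : ∀ {φ ψ} → BindsIn x φ → BindsIn x (φ ∨p ψ)
    borr  : ∀ {φ ψ} → BindsIn x ψ → BindsIn x (φ ∨p ψ)
    bappl : ∀ {φ ψ} → BindsIn x φ → BindsIn x (φ · ψ)
    bappr : ∀ {φ ψ} → BindsIn x ψ → BindsIn x (φ · ψ)
    ballb : ∀ {φ} → BindsIn x (all x φ)
    ball  : ∀ {y φ} → BindsIn x φ → BindsIn x (all y φ)
    bexb  : ∀ {φ} → BindsIn x (ex x φ)
    bex   : ∀ {y φ} → BindsIn x φ → BindsIn x (ex y φ)

  free⇒occurs : ∀ {x} {φ : Pattern S} → FreeIn x φ → Occurs x φ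
  free⇒occurs fvar      = ovar
  free⇒occurs (fneg f)  = oneg (free⇒occurs f)
  free⇒occurs (fimpl f) = oimpl (free⇒occurs f)
  free⇒occurs (fimpr f) = oimpr (free⇒occurs f)
  free⇒occurs (fandl f) = oandl (free⇒occurs f)
  free⇒occurs (fandr f) = oandr (free⇒occurs f)
  free⇒occurs (forl f)  = oorl (free⇒occurs f)
  free⇒occurs (forr f)  = oorr (free⇒occurs f)
  free⇒occurs (fappl f) = oappl (free⇒occurs f)
  free⇒occurs (fappr f) = oappr (free⇒occurs f)
  free⇒occurs (fall _ f) = oall (free⇒occurs f)
  free⇒occurs (fex _ f)  = oex (free⇒occurs f)

  occurs⇒free⊎binds : ∀ {x} {φ : Pattern S} → Occurs x φ → FreeIn x φ ⊎ BindsIn x φ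
  occurs⇒free⊎binds ovar      = inj₁ fvar
  occurs⇒free⊎binds (oneg o)  = Sum.map fneg bneg (occurs⇒free⊎binds o)
  occurs⇒free⊎binds (oimpl o) = Sum.map fimpl bimpl (occurs⇒free⊎binds o)
  occurs⇒free⊎binds (oimpr o) = Sum.map fimpr bimpr (occurs⇒free⊎binds o)
  occurs⇒free⊎binds (oandl o) = Sum.map fandl bandl (occurs⇒free⊎binds o)
  occurs⇒free⊎binds (oandr o) = Sum.map fandr bandr (occurs⇒free⊎binds o)
  occurs⇒free⊎binds (oorl o)  = Sum.map forl borl (occurs⇒free⊎binds o)
  occurs⇒free⊎binds (oorr o)  = Sum.map forr borr (occurs⇒free⊎binds o)
  occurs⇒free⊎binds (oappl o) = Sum.map fappl bappl (occurs⇒free⊎binds o)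
  occurs⇒free⊎binds (oappr o) = Sum.map fappr bappr (occurs⇒free⊎binds o)
  occurs⇒free⊎binds oallb     = inj₂ ballb
  occurs⇒free⊎binds {x} (oall {y} o) with occurs⇒free⊎binds o | y ≟ x
  ... | inj₂ b | _        = inj₂ (ball b)
  ... | inj₁ _ | yes refl = inj₂ ballb
  ... | inj₁ f | no y≢x   = inj₁ (fall y≢x f)
  occurs⇒free⊎binds oexb      = inj₂ bexb
  occurs⇒free⊎binds {x} (oex {y} o) with occurs⇒free⊎binds o | y ≟ x
  ... | inj₂ b | _        = inj₂ (bex b)
  ... | inj₁ _ | yes refl = inj₂ bexb
  ... | inj₁ f | no y≢x   = inj₁ (fex y≢x f)

  ∉-all : ∀ {z x} {φ : Pattern S} → z ≢ x → ¬ Occurs z φ → ¬ Occurs z (all x φ)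
  ∉-all z≢x z∉ oallb    = z≢x refl
  ∉-all z≢x z∉ (oall o) = z∉ o

  maxVar : Pattern S → ℕ
  maxVar (var v)   = v
  maxVar (sym _)   = 0
  maxVar ⊥p        = 0
  maxVar (¬p a)    = maxVar a
  maxVar (a ⇒ b)   = maxVar a ⊔ maxVar b
  maxVar (a ∧p b)  = maxVar a ⊔ maxVar b
  maxVar (a ∨p b)  = maxVar a ⊔ maxVar b
  maxVar (a · b)   = maxVar a ⊔ maxVar b
  maxVar (all v a) = v ⊔ maxVar a
  maxVar (ex v a)  = v ⊔ maxVar a

  occurs⇒≤maxVar : ∀ {z} {φ : Pattern S} → Occurs z φ → z ≤ maxVar φ
  occurs⇒≤maxVar ovar      = ≤-refl
  occurs⇒≤maxVar (oneg o)  = occurs⇒≤maxVar o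
  occurs⇒≤maxVar (oimpl o) = ≤-trans (occurs⇒≤maxVar o) (m≤m⊔n _ _)
  occurs⇒≤maxVar (oimpr o) = ≤-trans (occurs⇒≤maxVar o) (m≤n⊔m _ _)
  occurs⇒≤maxVar (oandl o) = ≤-trans (occurs⇒≤maxVar o) (m≤m⊔n _ _)
  occurs⇒≤maxVar (oandr o) = ≤-trans (occurs⇒≤maxVar o) (m≤n⊔m _ _)
  occurs⇒≤maxVar (oorl o)  = ≤-trans (occurs⇒≤maxVar o) (m≤m⊔n _ _)
  occurs⇒≤maxVar (oorr o)  = ≤-trans (occurs⇒≤maxVar o) (m≤n⊔m _ _)
  occurs⇒≤maxVar (oappl o) = ≤-trans (occurs⇒≤maxVar o) (m≤m⊔n _ _)
  occurs⇒≤maxVar (oappr o) = ≤-trans (occurs⇒≤maxVar o) (m≤n⊔m _ _)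
  occurs⇒≤maxVar oallb     = m≤m⊔n _ _
  occurs⇒≤maxVar (oall o)  = ≤-trans (occurs⇒≤maxVar o) (m≤n⊔m _ _)
  occurs⇒≤maxVar oexb      = m≤m⊔n _ _
  occurs⇒≤maxVar (oex o)   = ≤-trans (occurs⇒≤maxVar o) (m≤n⊔m _ _)

  fresh : EVar → Pattern S → EVar
  fresh x φ = suc (x ⊔ maxVar φ)

  fresh-∉ : ∀ x (φ : Pattern S) → ¬ Occurs (fresh x φ) φ
  fresh-∉ x φ o = 1+n≰n (≤-trans (occurs⇒≤maxVar o) (m≤n⊔m x (maxVar φ)))

  fresh-≢ : ∀ x (φ : Pattern S) → fresh x φ ≢ x
  fresh-≢ x φ e = <⇒≢ (s≤s (m≤m⊔n x (maxVar φ))) (≡.sym e)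

  Subf-var-self : ∀ x y → Subf {S} x y (var x) ≡ var y
  Subf-var-self x y with x ≟ x
  ... | yes _   = refl
  ... | no x≢x = ⊥-elim (x≢x refl)

  Subf-var-≢ : ∀ {x y v} → v ≢ x → Subf {S} x y (var v) ≡ var v
  Subf-var-≢ {x} {v = v} v≢x with v ≟ x
  ... | yes v≡x = ⊥-elim (v≢x v≡x)
  ... | no _    = refl

  Subf-all-≢ : ∀ {x y w} {φ : Pattern S} → w ≢ x → Subf x y (all w φ) ≡ all w (Subf x y φ)
  Subf-all-≢ {x} {w = w} w≢x with w ≟ x
  ... | yes w≡x = ⊥-elim (w≢x w≡x)
  ... | no _    = refl

  Subf-ex-≢ : ∀ {x y w} {φ : Pattern S} → w ≢ x → Subf x y (ex w φ) ≡ ex w (Subf x y φ)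
  Subf-ex-≢ {x} {w = w} w≢x with w ≟ x
  ... | yes w≡x = ⊥-elim (w≢x w≡x)
  ... | no _    = refl

  Subf-id : ∀ x (φ : Pattern S) → Subf x x φ ≡ φ
  Subf-id x (var v) with v ≟ x
  ... | yes refl = refl
  ... | no _     = refl
  Subf-id x (sym s)  = refl
  Subf-id x ⊥p       = refl
  Subf-id x (¬p a)   = cong ¬p (Subf-id x a)
  Subf-id x (a ⇒ b)  = cong₂ _⇒_ (Subf-id x a) (Subf-id x b)
  Subf-id x (a ∧p b) = cong₂ _∧p_ (Subf-id x a) (Subf-id x b)
  Subf-id x (a ∨p b) = cong₂ _∨p_ (Subf-id x a) (Subf-id x b)
  Subf-id x (a · b)  = cong₂ _·_ (Subf-id x a) (Subf-id x b)
  Subf-id x (all w a) with w ≟ x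
  ... | yes _ = refl
  ... | no _  = cong (all w) (Subf-id x a)
  Subf-id x (ex w a) with w ≟ x
  ... | yes _ = refl
  ... | no _  = cong (ex w) (Subf-id x a)

  Subf-notFree : ∀ x y (φ : Pattern S) → ¬ FreeIn x φ → Subf x y φ ≡ φ
  Subf-notFree x y (var v) nf with v ≟ x
  ... | yes refl = ⊥-elim (nf fvar)
  ... | no _     = refl
  Subf-notFree x y (sym s) nf = refl
  Subf-notFree x y ⊥p nf      = refl
  Subf-notFree x y (¬p a) nf  = cong ¬p (Subf-notFree x y a (nf ∘ fneg))
  Subf-notFree x y (a ⇒ b) nf =
    cong₂ _⇒_ (Subf-notFree x y a (nf ∘ fimpl)) (Subf-notFree x y b (nf ∘ fimpr))
  Subf-notFree x y (a ∧p b) nf =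
    cong₂ _∧p_ (Subf-notFree x y a (nf ∘ fandl)) (Subf-notFree x y b (nf ∘ fandr))
  Subf-notFree x y (a ∨p b) nf =
    cong₂ _∨p_ (Subf-notFree x y a (nf ∘ forl)) (Subf-notFree x y b (nf ∘ forr))
  Subf-notFree x y (a · b) nf =
    cong₂ _·_ (Subf-notFree x y a (nf ∘ fappl)) (Subf-notFree x y b (nf ∘ fappr))
  Subf-notFree x y (all w a) nf with w ≟ x
  ... | yes _  = refl
  ... | no w≢x = cong (all w) (Subf-notFree x y a (nf ∘ fall w≢x))
  Subf-notFree x y (ex w a) nf with w ≟ x
  ... | yes _  = refl
  ... | no w≢x = cong (ex w) (Subf-notFree x y a (nf ∘ fex w≢x))

  free-Subf : ∀ x z (φ : Pattern S) → FreeIn x (Subf x z φ) → x ≡ z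
  free-Subf x z (var v) f with v ≟ x
  free-Subf x z (var v) fvar | yes _  = refl
  free-Subf x z (var v) fvar | no x≢x = ⊥-elim (x≢x refl)
  free-Subf x z (¬p a) (fneg f)    = free-Subf x z a f
  free-Subf x z (a ⇒ b) (fimpl f)  = free-Subf x z a f
  free-Subf x z (a ⇒ b) (fimpr f)  = free-Subf x z b f
  free-Subf x z (a ∧p b) (fandl f) = free-Subf x z a f
  free-Subf x z (a ∧p b) (fandr f) = free-Subf x z b f
  free-Subf x z (a ∨p b) (forl f)  = free-Subf x z a f
  free-Subf x z (a ∨p b) (forr f)  = free-Subf x z b f
  free-Subf x z (a · b) (fappl f)  = free-Subf x z a f
  free-Subf x z (a · b) (fappr f)  = free-Subf x z b f
  free-Subf x z (all w a) f with w ≟ x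
  free-Subf x z (all w a) (fall w≢x _) | yes w≡x = ⊥-elim (w≢x w≡x)
  free-Subf x z (all w a) (fall _ f)   | no _    = free-Subf x z a f
  free-Subf x z (ex w a) f with w ≟ x
  free-Subf x z (ex w a) (fex w≢x _) | yes w≡x = ⊥-elim (w≢x w≡x)
  free-Subf x z (ex w a) (fex _ f)   | no _    = free-Subf x z a f

  binds-Subf : ∀ v x z (φ : Pattern S) → BindsIn v (Subf x z φ) → BindsIn v φ
  binds-Subf v x z (var u) b with u ≟ x
  binds-Subf v x z (var u) () | yes _
  binds-Subf v x z (var u) () | no _
  binds-Subf v x z (¬p a) (bneg b)    = bneg (binds-Subf v x z a b)
  binds-Subf v x z (a ⇒ c) (bimpl b)  = bimpl (binds-Subf v x z a b)
  binds-Subf v x z (a ⇒ c) (bimpr b)  = bimpr (binds-Subf v x z c b)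
  binds-Subf v x z (a ∧p c) (bandl b) = bandl (binds-Subf v x z a b)
  binds-Subf v x z (a ∧p c) (bandr b) = bandr (binds-Subf v x z c b)
  binds-Subf v x z (a ∨p c) (borl b)  = borl (binds-Subf v x z a b)
  binds-Subf v x z (a ∨p c) (borr b)  = borr (binds-Subf v x z c b)
  binds-Subf v x z (a · c) (bappl b)  = bappl (binds-Subf v x z a b)
  binds-Subf v x z (a · c) (bappr b)  = bappr (binds-Subf v x z c b)
  binds-Subf v x z (all w a) b with w ≟ x
  ... | yes _ = b
  binds-Subf v x z (all w a) ballb    | no _ = ballb
  binds-Subf v x z (all w a) (ball b) | no _ = ball (binds-Subf v x z a b)
  binds-Subf v x z (ex w a) b with w ≟ x
  ... | yes _ = b
  binds-Subf v x z (ex w a) bexb    | no _ = bexb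
  binds-Subf v x z (ex w a) (bex b) | no _ = bex (binds-Subf v x z a b)

  ∉-Subf : ∀ x z (φ : Pattern S) → ¬ BindsIn x φ → x ≢ z → ¬ Occurs x (Subf x z φ)
  ∉-Subf x z φ nb x≢z o with occurs⇒free⊎binds o
  ... | inj₁ f = x≢z (free-Subf x z φ f)
  ... | inj₂ b = nb (binds-Subf x x z φ b)

  Subf-inverse : ∀ x z (φ : Pattern S) → ¬ Occurs z φ → Subf z x (Subf x z φ) ≡ φ
  Subf-inverse x z (var v) z∉ with v ≟ x
  ... | yes refl = Subf-var-self z v
  ... | no _     = Subf-var-≢ λ { refl → z∉ ovar }
  Subf-inverse x z (sym _) z∉ = refl
  Subf-inverse x z ⊥p z∉      = refl
  Subf-inverse x z (¬p a) z∉  = cong ¬p (Subf-inverse x z a (z∉ ∘ oneg))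
  Subf-inverse x z (a ⇒ b) z∉ =
    cong₂ _⇒_ (Subf-inverse x z a (z∉ ∘ oimpl)) (Subf-inverse x z b (z∉ ∘ oimpr))
  Subf-inverse x z (a ∧p b) z∉ =
    cong₂ _∧p_ (Subf-inverse x z a (z∉ ∘ oandl)) (Subf-inverse x z b (z∉ ∘ oandr))
  Subf-inverse x z (a ∨p b) z∉ =
    cong₂ _∨p_ (Subf-inverse x z a (z∉ ∘ oorl)) (Subf-inverse x z b (z∉ ∘ oorr))
  Subf-inverse x z (a · b) z∉ =
    cong₂ _·_ (Subf-inverse x z a (z∉ ∘ oappl)) (Subf-inverse x z b (z∉ ∘ oappr))
  Subf-inverse x z (all w a) z∉ with w ≟ x
  ... | yes refl = ≡.trans (Subf-all-≢ λ { refl → z∉ oallb })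
                           (cong (all w) (Subf-notFree z w a (z∉ ∘ oall ∘ free⇒occurs)))
  ... | no _     = ≡.trans (Subf-all-≢ λ { refl → z∉ oallb })
                           (cong (all w) (Subf-inverse x z a (z∉ ∘ oall)))
  Subf-inverse x z (ex w a) z∉ with w ≟ x
  ... | yes refl = ≡.trans (Subf-ex-≢ λ { refl → z∉ oexb })
                           (cong (ex w) (Subf-notFree z w a (z∉ ∘ oex ∘ free⇒occurs)))
  ... | no _     = ≡.trans (Subf-ex-≢ λ { refl → z∉ oexb })
                           (cong (ex w) (Subf-inverse x z a (z∉ ∘ oex)))

  freeForBinder-target : ∀ {x y} {φ : Pattern S} →
                         x ≢ y → ¬ FreeIn x φ → FreeForBinder x y y φ
  freeForBinder-target {x} {y} x≢y nf with y ≟ x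
  ... | yes y≡x = ⊥-elim (x≢y (≡.sym y≡x))
  ... | no _ with y ≟ y
  ...   | yes _   = nf
  ...   | no y≢y = ⊥-elim (y≢y refl)

  freeForBinder-other : ∀ {x y w} {φ : Pattern S} →
                        w ≢ x → w ≢ y → FreeFor x y φ → FreeForBinder x y w φ
  freeForBinder-other {x} {y} {w} w≢x w≢y ff with w ≟ x
  ... | yes w≡x = ⊥-elim (w≢x w≡x)
  ... | no _ with w ≟ y
  ...   | yes w≡y = ⊥-elim (w≢y w≡y)
  ...   | no _    = ff

  freeFor-∉ : ∀ x z (φ : Pattern S) → ¬ Occurs z φ → FreeFor x z φ
  freeFor-∉ x z (var _) z∉  = tt
  freeFor-∉ x z (sym _) z∉  = tt
  freeFor-∉ x z ⊥p z∉       = tt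
  freeFor-∉ x z (¬p a) z∉   = freeFor-∉ x z a (z∉ ∘ oneg)
  freeFor-∉ x z (a ⇒ b) z∉  = freeFor-∉ x z a (z∉ ∘ oimpl) , freeFor-∉ x z b (z∉ ∘ oimpr)
  freeFor-∉ x z (a ∧p b) z∉ = freeFor-∉ x z a (z∉ ∘ oandl) , freeFor-∉ x z b (z∉ ∘ oandr)
  freeFor-∉ x z (a ∨p b) z∉ = freeFor-∉ x z a (z∉ ∘ oorl) , freeFor-∉ x z b (z∉ ∘ oorr)
  freeFor-∉ x z (a · b) z∉  = freeFor-∉ x z a (z∉ ∘ oappl) , freeFor-∉ x z b (z∉ ∘ oappr)
  freeFor-∉ x z (all w a) z∉ with w ≟ x
  ... | yes _    = tt
  ... | no _ with w ≟ z
  ...   | yes refl = ⊥-elim (z∉ oallb)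
  ...   | no _     = freeFor-∉ x z a (z∉ ∘ oall)
  freeFor-∉ x z (ex w a) z∉ with w ≟ x
  ... | yes _    = tt
  ... | no _ with w ≟ z
  ...   | yes refl = ⊥-elim (z∉ oexb)
  ...   | no _     = freeFor-∉ x z a (z∉ ∘ oex)

  freeFor-Subf-inverse : ∀ x z (φ : Pattern S) → ¬ Occurs z φ → FreeFor z x (Subf x z φ)
  freeFor-Subf-inverse x z (var v) z∉ with v ≟ x
  ... | yes _ = tt
  ... | no _  = tt
  freeFor-Subf-inverse x z (sym _) z∉ = tt
  freeFor-Subf-inverse x z ⊥p z∉      = tt
  freeFor-Subf-inverse x z (¬p a) z∉  = freeFor-Subf-inverse x z a (z∉ ∘ oneg)
  freeFor-Subf-inverse x z (a ⇒ b) z∉ =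
    freeFor-Subf-inverse x z a (z∉ ∘ oimpl) , freeFor-Subf-inverse x z b (z∉ ∘ oimpr)
  freeFor-Subf-inverse x z (a ∧p b) z∉ =
    freeFor-Subf-inverse x z a (z∉ ∘ oandl) , freeFor-Subf-inverse x z b (z∉ ∘ oandr)
  freeFor-Subf-inverse x z (a ∨p b) z∉ =
    freeFor-Subf-inverse x z a (z∉ ∘ oorl) , freeFor-Subf-inverse x z b (z∉ ∘ oorr)
  freeFor-Subf-inverse x z (a · b) z∉ =
    freeFor-Subf-inverse x z a (z∉ ∘ oappl) , freeFor-Subf-inverse x z b (z∉ ∘ oappr)
  freeFor-Subf-inverse x z (all w a) z∉ with w ≟ x
  ... | yes refl = freeForBinder-target {y = w} (λ { refl → z∉ oallb }) (z∉ ∘ oall ∘ free⇒occurs)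
  ... | no w≢x   = freeForBinder-other (λ { refl → z∉ oallb }) w≢x
                                       (freeFor-Subf-inverse x z a (z∉ ∘ oall))
  freeFor-Subf-inverse x z (ex w a) z∉ with w ≟ x
  ... | yes refl = freeForBinder-target {y = w} (λ { refl → z∉ oexb }) (z∉ ∘ oex ∘ free⇒occurs)
  ... | no w≢x   = freeForBinder-other (λ { refl → z∉ oexb }) w≢x
                                       (freeFor-Subf-inverse x z a (z∉ ∘ oex))

  binds-all : ∀ {x w} {φ : Pattern S} → BindsIn x (all w φ) → x ≡ w ⊎ BindsIn x φ
  binds-all ballb    = inj₁ refl
  binds-all (ball b) = inj₂ b

  binds-ex : ∀ {x w} {φ : Pattern S} → BindsIn x (ex w φ) → x ≡ w ⊎ BindsIn x φ
  binds-ex bexb    = inj₁ refl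
  binds-ex (bex b) = inj₂ b

  unbind : EVar → Pattern S → Pattern S
  unbind x (var v)   = var v
  unbind x (sym s)   = sym s
  unbind x ⊥p        = ⊥p
  unbind x (¬p a)    = ¬p (unbind x a)
  unbind x (a ⇒ b)   = unbind x a ⇒ unbind x b
  unbind x (a ∧p b)  = unbind x a ∧p unbind x b
  unbind x (a ∨p b)  = unbind x a ∨p unbind x b
  unbind x (a · b)   = unbind x a · unbind x b
  unbind x (all w a) with w ≟ x
  ... | yes _ = all (fresh x (unbind x a)) (Subf x (fresh x (unbind x a)) (unbind x a))
  ... | no _  = all w (unbind x a)
  unbind x (ex w a) with w ≟ x
  ... | yes _ = ex (fresh x (unbind x a)) (Subf x (fresh x (unbind x a)) (unbind x a))
  ... | no _  = ex w (unbind x a)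

  unbind-¬binds : ∀ x (φ : Pattern S) → ¬ BindsIn x (unbind x φ)
  unbind-¬binds x (¬p a) (bneg b)    = unbind-¬binds x a b
  unbind-¬binds x (a ⇒ c) (bimpl b)  = unbind-¬binds x a b
  unbind-¬binds x (a ⇒ c) (bimpr b)  = unbind-¬binds x c b
  unbind-¬binds x (a ∧p c) (bandl b) = unbind-¬binds x a b
  unbind-¬binds x (a ∧p c) (bandr b) = unbind-¬binds x c b
  unbind-¬binds x (a ∨p c) (borl b)  = unbind-¬binds x a b
  unbind-¬binds x (a ∨p c) (borr b)  = unbind-¬binds x c b
  unbind-¬binds x (a · c) (bappl b)  = unbind-¬binds x a b
  unbind-¬binds x (a · c) (bappr b)  = unbind-¬binds x c b
  unbind-¬binds x (all w a) b with w ≟ x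
  ... | yes _ with binds-all b
  ...   | inj₁ x≡z = fresh-≢ x (unbind x a) (≡.sym x≡z)
  ...   | inj₂ b′  = unbind-¬binds x a (binds-Subf x x _ (unbind x a) b′)
  unbind-¬binds x (all w a) b | no w≢x with binds-all b
  ...   | inj₁ x≡w = w≢x (≡.sym x≡w)
  ...   | inj₂ b′  = unbind-¬binds x a b′
  unbind-¬binds x (ex w a) b with w ≟ x
  ... | yes _ with binds-ex b
  ...   | inj₁ x≡z = fresh-≢ x (unbind x a) (≡.sym x≡z)
  ...   | inj₂ b′  = unbind-¬binds x a (binds-Subf x x _ (unbind x a) b′)
  unbind-¬binds x (ex w a) b | no w≢x with binds-ex b
  ...   | inj₁ x≡w = w≢x (≡.sym x≡w)
  ...   | inj₂ b′  = unbind-¬binds x a b′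

  unbind-free : ∀ x (φ : Pattern S) → FreeIn x (unbind x φ) → FreeIn x φ
  unbind-free x (var v) f            = f
  unbind-free x (¬p a) (fneg f)      = fneg (unbind-free x a f)
  unbind-free x (a ⇒ c) (fimpl f)    = fimpl (unbind-free x a f)
  unbind-free x (a ⇒ c) (fimpr f)    = fimpr (unbind-free x c f)
  unbind-free x (a ∧p c) (fandl f)   = fandl (unbind-free x a f)
  unbind-free x (a ∧p c) (fandr f)   = fandr (unbind-free x c f)
  unbind-free x (a ∨p c) (forl f)    = forl (unbind-free x a f)
  unbind-free x (a ∨p c) (forr f)    = forr (unbind-free x c f)
  unbind-free x (a · c) (fappl f)    = fappl (unbind-free x a f)
  unbind-free x (a · c) (fappr f)    = fappr (unbind-free x c f)
  unbind-free x (all w a) f with w ≟ x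
  unbind-free x (all w a) (fall _ f) | yes _ =
    ⊥-elim (fresh-≢ x (unbind x a) (≡.sym (free-Subf x _ (unbind x a) f)))
  unbind-free x (all w a) (fall w≢x f) | no _ = fall w≢x (unbind-free x a f)
  unbind-free x (ex w a) f with w ≟ x
  unbind-free x (ex w a) (fex _ f) | yes _ =
    ⊥-elim (fresh-≢ x (unbind x a) (≡.sym (free-Subf x _ (unbind x a) f)))
  unbind-free x (ex w a) (fex w≢x f) | no _ = fex w≢x (unbind-free x a f)

  unbind-∉ : ∀ x (φ : Pattern S) → ¬ FreeIn x φ → ¬ Occurs x (unbind x φ)
  unbind-∉ x φ nf o with occurs⇒free⊎binds o
  ... | inj₁ f = nf (unbind-free x φ f)
  ... | inj₂ b = unbind-¬binds x φ b

module MGDerivations {S : Set} (dfd : S) (Γ : Pattern S → Set) where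
  open Definedness dfd

  infix 3 ⊢_
  ⊢_ : Pattern S → Set
  ⊢ φ = _⊢MG_ dfd Γ φ

  infix 4 _≅_
  _≅_ : Pattern S → Pattern S → Set
  a ≅ b = (⊢ a ⇒ b) × (⊢ b ⇒ a)

  ∧-elimˡ : ∀ {a b} → ⊢ a ∧p b ⇒ a
  ∧-elimˡ {a} {b} = shared (ax-and-elim a b)

  ∧-comm : ∀ {a b} → ⊢ a ∧p b ⇒ b ∧p a
  ∧-comm {a} {b} = shared (ax-and-comm a b)

  ∧-elimʳ : ∀ {a b} → ⊢ a ∧p b ⇒ b
  ∧-elimʳ = syll ∧-comm ∧-elimˡ

  ⇒-refl : ∀ {a} → ⊢ a ⇒ a
  ⇒-refl {a} = syll (shared (ax-and-dup a)) ∧-elimˡ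

  ∨-introˡ : ∀ {a b} → ⊢ a ⇒ a ∨p b
  ∨-introˡ {a} {b} = shared (ax-or-intro a b)

  ∨-introʳ : ∀ {a b} → ⊢ b ⇒ a ∨p b
  ∨-introʳ {a} {b} = syll ∨-introˡ (shared (ax-or-comm b a))

  ex-falso : ∀ {a} → ⊢ ⊥p ⇒ a
  ex-falso {a} = shared (ax-bot a)

  ¬-elim : ∀ {a} → ⊢ ¬p a ⇒ (a ⇒ ⊥p)
  ¬-elim {a} = shared (ax-neg-elim a)

  ¬-intro : ∀ {a} → ⊢ (a ⇒ ⊥p) ⇒ ¬p a
  ¬-intro {a} = shared (ax-neg-intro a)

  ⇒-const : ∀ {a b} → ⊢ a ⇒ (b ⇒ a)
  ⇒-const = exportR ∧-elimˡ

  weaken : ∀ {a b} → ⊢ b → ⊢ a ⇒ b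
  weaken p = mp p ⇒-const

  ∧-monoˡ : ∀ {a a′ c} → ⊢ a ⇒ a′ → ⊢ a ∧p c ⇒ a′ ∧p c
  ∧-monoˡ p = importR (syll p (exportR ⇒-refl))

  ∧-monoʳ : ∀ {a c c′} → ⊢ c ⇒ c′ → ⊢ a ∧p c ⇒ a ∧p c′
  ∧-monoʳ p = syll ∧-comm (syll (∧-monoˡ p) ∧-comm)

  ∧-intro : ∀ {h b c} → ⊢ h ⇒ b → ⊢ h ⇒ c → ⊢ h ⇒ b ∧p c
  ∧-intro {h} p q = syll (shared (ax-and-dup h)) (syll (∧-monoʳ q) (∧-monoˡ p))

  ∨-elim : ∀ {a b c} → ⊢ a ⇒ c → ⊢ b ⇒ c → ⊢ a ∨p b ⇒ c
  ∨-elim {a} {b} {c} p q =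
    syll (expan a q) (syll (shared (ax-or-comm a c)) (syll (expan c p) (shared (ax-or-idem c))))

  ∨-mono : ∀ {a a′ b b′} → ⊢ a ⇒ a′ → ⊢ b ⇒ b′ → ⊢ a ∨p b ⇒ a′ ∨p b′
  ∨-mono p q = ∨-elim (syll p ∨-introˡ) (syll q ∨-introʳ)

  exchange : ∀ {a b c} → ⊢ a ⇒ (b ⇒ c) → ⊢ b ⇒ (a ⇒ c)
  exchange p = exportR (syll ∧-comm (importR p))

  mp-under : ∀ {h a b} → ⊢ h ⇒ (a ⇒ b) → ⊢ h ⇒ a → ⊢ h ⇒ b
  mp-under p q = syll (∧-intro ⇒-refl q) (importR p)

  syll-under : ∀ {h a b c} → ⊢ h ⇒ (a ⇒ b) → ⊢ h ⇒ (b ⇒ c) → ⊢ h ⇒ (a ⇒ c)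
  syll-under p q = exportR (mp-under (syll ∧-elimˡ q) (importR p))

  ⇒-mono : ∀ {a a′ b b′} → ⊢ a′ ⇒ a → ⊢ b ⇒ b′ → ⊢ (a ⇒ b) ⇒ (a′ ⇒ b′)
  ⇒-mono p q = exportR (syll (mp-under ∧-elimˡ (syll ∧-elimʳ p)) q)

  contraposition : ∀ {a b} → ⊢ (a ⇒ b) ⇒ (¬p b ⇒ ¬p a)
  contraposition = exportR (syll (exportR (mp-under (syll (syll ∧-elimˡ ∧-elimʳ) ¬-elim)
                                                    (mp-under (syll ∧-elimˡ ∧-elimˡ) ∧-elimʳ)))
                                 ¬-intro)

  contrapose : ∀ {a b} → ⊢ a ⇒ b → ⊢ ¬p b ⇒ ¬p a
  contrapose p = mp p contraposition

  ¬¬-intro : ∀ {a} → ⊢ a ⇒ ¬p (¬p a)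
  ¬¬-intro = syll (exchange ¬-elim) ¬-intro

  ¬-⇒-anything : ∀ {a b} → ⊢ ¬p a ⇒ (a ⇒ b)
  ¬-⇒-anything = syll-under ¬-elim (weaken ex-falso)

  ¬¬-elim : ∀ {a} → ⊢ ¬p (¬p a) ⇒ a
  ¬¬-elim {a} = mp (shared (ax-lem a)) (∨-elim ⇒-const (exchange ¬-⇒-anything))

  ¬-mono-under : ∀ {h a b} → ⊢ h ⇒ (a ⇒ b) → ⊢ h ⇒ (¬p b ⇒ ¬p a)
  ¬-mono-under p = syll p contraposition

  ⇒-mono-under : ∀ {h a a′ b b′} → ⊢ h ⇒ (a′ ⇒ a) → ⊢ h ⇒ (b ⇒ b′) → ⊢ h ⇒ ((a ⇒ b) ⇒ (a′ ⇒ b′))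
  ⇒-mono-under p q = exportR (syll-under (syll ∧-elimˡ p) (syll-under ∧-elimʳ (syll ∧-elimˡ q)))

  ∧-mono-under : ∀ {h a a′ b b′} → ⊢ h ⇒ (a ⇒ a′) → ⊢ h ⇒ (b ⇒ b′) → ⊢ h ⇒ (a ∧p b ⇒ a′ ∧p b′)
  ∧-mono-under p q = exportR (∧-intro (mp-under (syll ∧-elimˡ p) (syll ∧-elimʳ ∧-elimˡ))
                                      (mp-under (syll ∧-elimˡ q) (syll ∧-elimʳ ∧-elimʳ)))

  ∨-mono-under : ∀ {h a a′ b b′} → ⊢ h ⇒ (a ⇒ a′) → ⊢ h ⇒ (b ⇒ b′) → ⊢ h ⇒ (a ∨p b ⇒ a′ ∨p b′)
  ∨-mono-under p q = exchange (∨-elim (exchange (syll-under p (weaken ∨-introˡ)))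
                                      (exchange (syll-under q (weaken ∨-introʳ))))

  ∀-mono : ∀ x {a b} → ⊢ a ⇒ b → ⊢ all x a ⇒ all x b
  ∀-mono x {a} {b} p = mp (gen x p) (ax-K x a b)

  ∃-mono-∀ : ∀ x {a b} → ⊢ all x (a ⇒ b) ⇒ (ex x a ⇒ ex x b)
  ∃-mono-∀ x {a} {b} =
    syll (syll (syll (∀-mono x contraposition) (ax-K x (¬p b) (¬p a))) contraposition)
         (⇒-mono (ax-ex-dual1 x a) (ax-ex-dual2 x b))

  ∃-mono : ∀ x {a b} → ⊢ a ⇒ b → ⊢ ex x a ⇒ ex x b
  ∃-mono x p = mp (gen x p) (∃-mono-∀ x)

  ∀-mono-under : ∀ {h} w {a a′} → ¬ Occurs w h → ⊢ h ⇒ (a ⇒ a′) → ⊢ h ⇒ (all w a ⇒ all w a′)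
  ∀-mono-under {h} w {a} {a′} w∉h p = syll (ax-vacall w h w∉h) (syll (∀-mono w p) (ax-K w a a′))

  ∃-mono-under : ∀ {h} w {a a′} → ¬ Occurs w h → ⊢ h ⇒ (a ⇒ a′) → ⊢ h ⇒ (ex w a ⇒ ex w a′)
  ∃-mono-under {h} w w∉h p = syll (ax-vacall w h w∉h) (syll (∀-mono w p) (∃-mono-∀ w))

  ∃-vacuous : ∀ x ψ → ¬ Occurs x ψ → ⊢ ex x ψ ⇒ ψ
  ∃-vacuous x ψ x∉ψ =
    syll (ax-ex-dual1 x ψ) (syll (contrapose (ax-vacall x (¬p ψ) λ { (oneg o) → x∉ψ o })) ¬¬-elim)

  ≅-trans : ∀ {a b c} → a ≅ b → b ≅ c → a ≅ c
  ≅-trans (p , q) (r , s) = syll p r , syll s q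

  ¬-cong : ∀ {a a′} → a ≅ a′ → ¬p a ≅ ¬p a′
  ¬-cong (p , q) = contrapose q , contrapose p

  ⇒-cong : ∀ {a a′ b b′} → a ≅ a′ → b ≅ b′ → (a ⇒ b) ≅ (a′ ⇒ b′)
  ⇒-cong (p , q) (r , s) = ⇒-mono q r , ⇒-mono p s

  ∧-cong : ∀ {a a′ b b′} → a ≅ a′ → b ≅ b′ → (a ∧p b) ≅ (a′ ∧p b′)
  ∧-cong (p , q) (r , s) = syll (∧-monoˡ p) (∧-monoʳ r) , syll (∧-monoˡ q) (∧-monoʳ s)

  ∨-cong : ∀ {a a′ b b′} → a ≅ a′ → b ≅ b′ → (a ∨p b) ≅ (a′ ∨p b′)
  ∨-cong (p , q) (r , s) = ∨-mono p r , ∨-mono q s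

  ·-cong : ∀ {a a′ b b′} → a ≅ a′ → b ≅ b′ → (a · b) ≅ (a′ · b′)
  ·-cong {a} {a′} {b} {b′} (p , q) (r , s) =
    syll (frameL b p) (frameR a′ r) , syll (frameL b′ q) (frameR a s)

  ∀-cong : ∀ x {a a′} → a ≅ a′ → all x a ≅ all x a′
  ∀-cong x (p , q) = ∀-mono x p , ∀-mono x q

  ∃-cong : ∀ x {a a′} → a ≅ a′ → ex x a ≅ ex x a′
  ∃-cong x (p , q) = ∃-mono x p , ∃-mono x q

  ·-⊥ : ∀ φ → ⊢ φ · ⊥p ⇒ ⊥p
  ·-⊥ φ = syll (frameR φ (ax-defin ⊥p)) (syll (ax-defR ⊥p φ) ax-defbot)

  ⊥-· : ∀ φ → ⊢ ⊥p · φ ⇒ ⊥p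
  ⊥-· φ = syll (frameL φ (ax-defin ⊥p)) (syll (ax-defL ⊥p φ) ax-defbot)

  ⌊⌋-elim : ∀ {φ} → ⊢ ⌊ φ ⌋ ⇒ φ
  ⌊⌋-elim {φ} = syll (contrapose (ax-defin (¬p φ))) ¬¬-elim

  module _ (φ : Pattern S) where

    ⌊⌋-split : ∀ {a} → ⊢ a ⇒ (⌊ φ ⌋ ∧p a) ∨p ¬p ⌊ φ ⌋
    ⌊⌋-split = mp (shared (ax-lem ⌊ φ ⌋))
                  (∨-elim (exportR ∨-introˡ) (exportR (syll ∧-elimˡ ∨-introʳ)))

    ⌊⌋-cancel : ∀ {a} → ⊢ ⌊ φ ⌋ ∧p (a ∨p ¬p ⌊ φ ⌋) ⇒ a
    ⌊⌋-cancel = importR (exchange (∨-elim ⇒-const ¬-⇒-anything))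

    ¬⌊⌋-absorbˡ : ∀ {b} → ⊢ ¬p ⌊ φ ⌋ · b ⇒ ¬p ⌊ φ ⌋
    ¬⌊⌋-absorbˡ {b} = syll (frameL b ¬¬-elim) (syll (ax-defL (¬p φ) b) ¬¬-intro)

    ¬⌊⌋-absorbʳ : ∀ {b} → ⊢ b · ¬p ⌊ φ ⌋ ⇒ ¬p ⌊ φ ⌋
    ¬⌊⌋-absorbʳ {b} = syll (frameR b ¬¬-elim) (syll (ax-defR (¬p φ) b) ¬¬-intro)

    ⌊⌋-pushˡ : ∀ {a b} → ⊢ ⌊ φ ⌋ ∧p (a · b) ⇒ (⌊ φ ⌋ ∧p a) · b
    ⌊⌋-pushˡ {a} {b} = syll (∧-monoʳ split) ⌊⌋-cancel
      where
      split : ⊢ a · b ⇒ (⌊ φ ⌋ ∧p a) · b ∨p ¬p ⌊ φ ⌋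
      split = syll (frameL b ⌊⌋-split)
                   (syll (shared (ax-prop-or-l _ _ b)) (∨-mono ⇒-refl ¬⌊⌋-absorbˡ))

    ⌊⌋-pushʳ : ∀ {a b} → ⊢ ⌊ φ ⌋ ∧p (a · b) ⇒ a · (⌊ φ ⌋ ∧p b)
    ⌊⌋-pushʳ {a} {b} = syll (∧-monoʳ split) ⌊⌋-cancel
      where
      split : ⊢ a · b ⇒ a · (⌊ φ ⌋ ∧p b) ∨p ¬p ⌊ φ ⌋
      split = syll (frameR a ⌊⌋-split)
                   (syll (shared (ax-prop-or-r _ _ a)) (∨-mono ⇒-refl ¬⌊⌋-absorbʳ))

    ·-mono-under-⌊⌋ : ∀ {a a′ b b′} → ⊢ ⌊ φ ⌋ ⇒ (a ⇒ a′) → ⊢ ⌊ φ ⌋ ⇒ (b ⇒ b′) →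
                      ⊢ ⌊ φ ⌋ ⇒ (a · b ⇒ a′ · b′)
    ·-mono-under-⌊⌋ {a} {a′} {b} {b′} p q = exportR (syll (∧-intro ∧-elimˡ left) right)
      where
      left : ⊢ ⌊ φ ⌋ ∧p (a · b) ⇒ a′ · b
      left = syll ⌊⌋-pushˡ (frameL b (importR p))
      right : ⊢ ⌊ φ ⌋ ∧p (a′ · b) ⇒ a′ · b′
      right = syll ⌊⌋-pushʳ (frameR a′ (importR q))

  module _ (x y : EVar) where

    private
      x≐y : Pattern S
      x≐y = var x ≐ var y

    ∉-≐ : ∀ {z} → z ≢ x → z ≢ y → ¬ Occurs z x≐y
    ∉-≐ z≢x z≢y (oneg (oappl ()))
    ∉-≐ z≢x z≢y (oneg (oappr (oneg (oandl (oimpl ovar))))) = z≢x refl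
    ∉-≐ z≢x z≢y (oneg (oappr (oneg (oandl (oimpr ovar))))) = z≢y refl
    ∉-≐ z≢x z≢y (oneg (oappr (oneg (oandr (oimpl ovar))))) = z≢y refl
    ∉-≐ z≢x z≢y (oneg (oappr (oneg (oandr (oimpr ovar))))) = z≢x refl

    ≐-Subf : ∀ φ → FreeFor x y φ → ⊢ x≐y ⇒ (φ ⇒ Subf x y φ) × ⊢ x≐y ⇒ (Subf x y φ ⇒ φ)
    ≐-Subf (var v) ff with v ≟ x
    ... | yes refl = syll ⌊⌋-elim ∧-elimˡ , syll ⌊⌋-elim ∧-elimʳ
    ... | no _     = weaken ⇒-refl , weaken ⇒-refl
    ≐-Subf (sym s) ff = weaken ⇒-refl , weaken ⇒-refl
    ≐-Subf ⊥p ff      = weaken ⇒-refl , weaken ⇒-refl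
    ≐-Subf (¬p a) ff with ≐-Subf a ff
    ... | p , q = ¬-mono-under q , ¬-mono-under p
    ≐-Subf (a ⇒ b) (ffa , ffb) with ≐-Subf a ffa | ≐-Subf b ffb
    ... | pa , qa | pb , qb = ⇒-mono-under qa pb , ⇒-mono-under pa qb
    ≐-Subf (a ∧p b) (ffa , ffb) with ≐-Subf a ffa | ≐-Subf b ffb
    ... | pa , qa | pb , qb = ∧-mono-under pa pb , ∧-mono-under qa qb
    ≐-Subf (a ∨p b) (ffa , ffb) with ≐-Subf a ffa | ≐-Subf b ffb
    ... | pa , qa | pb , qb = ∨-mono-under pa pb , ∨-mono-under qa qb
    ≐-Subf (a · b) (ffa , ffb) with ≐-Subf a ffa | ≐-Subf b ffb
    ... | pa , qa | pb , qb = ·-mono-under-⌊⌋ _ pa pb , ·-mono-under-⌊⌋ _ qa qb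
    ≐-Subf (all w a) ff with w ≟ x
    ... | yes _ = weaken ⇒-refl , weaken ⇒-refl
    ... | no w≢x with w ≟ y
    ...   | yes _ rewrite Subf-notFree x y a ff = weaken ⇒-refl , weaken ⇒-refl
    ...   | no w≢y with ≐-Subf a ff
    ...     | p , q = ∀-mono-under w (∉-≐ w≢x w≢y) p , ∀-mono-under w (∉-≐ w≢x w≢y) q
    ≐-Subf (ex w a) ff with w ≟ x
    ... | yes _ = weaken ⇒-refl , weaken ⇒-refl
    ... | no w≢x with w ≟ y
    ...   | yes _ rewrite Subf-notFree x y a ff = weaken ⇒-refl , weaken ⇒-refl
    ...   | no w≢y with ≐-Subf a ff
    ...     | p , q = ∃-mono-under w (∉-≐ w≢x w≢y) p , ∃-mono-under w (∉-≐ w≢x w≢y) q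

  ∀⇒∃-Subf : ∀ x y φ → x ≢ y → FreeFor x y φ → ⊢ all x φ ⇒ ex x (Subf x y φ)
  ∀⇒∃-Subf x y φ x≢y ff =
    mp-under (syll (∀-mono x (exchange (proj₁ (≐-Subf x y φ ff)))) (∃-mono-∀ x))
             (weaken (ax-exeq x y x≢y))

  ∀-inst-∉ : ∀ x y φ → x ≢ y → FreeFor x y φ → ¬ Occurs x (Subf x y φ) →
             ⊢ all x φ ⇒ Subf x y φ
  ∀-inst-∉ x y φ x≢y ff x∉ = syll (∀⇒∃-Subf x y φ x≢y ff) (∃-vacuous x _ x∉)

  α-∀ : ∀ x z φ → ¬ BindsIn x φ → ¬ Occurs z φ → z ≢ x → all x φ ≅ all z (Subf x z φ)
  α-∀ x z φ x-unbound z∉ z≢x = to , from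
    where
    x≢z : x ≢ z
    x≢z = z≢x ∘ ≡.sym
    x∉φ′ : ¬ Occurs x (Subf x z φ)
    x∉φ′ = ∉-Subf x z φ x-unbound x≢z
    to : ⊢ all x φ ⇒ all z (Subf x z φ)
    to = syll (ax-vacall z (all x φ) (∉-all z≢x z∉))
              (∀-mono z (∀-inst-∉ x z φ x≢z (freeFor-∉ x z φ z∉) x∉φ′))
    back : ⊢ all z (Subf x z φ) ⇒ Subf z x (Subf x z φ)
    back = ∀-inst-∉ z x (Subf x z φ) z≢x (freeFor-Subf-inverse x z φ z∉)
                    (subst (¬_ ∘ Occurs z) (≡.sym (Subf-inverse x z φ z∉)) z∉)
    from : ⊢ all z (Subf x z φ) ⇒ all x φ
    from = syll (ax-vacall x (all z (Subf x z φ)) (∉-all x≢z x∉φ′))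
                (∀-mono x (subst (λ ψ → ⊢ all z (Subf x z φ) ⇒ ψ) (Subf-inverse x z φ z∉)
                                 back))

  ∃-cong-dual : ∀ {x y a b} → all x (¬p a) ≅ all y (¬p b) → ex x a ≅ ex y b
  ∃-cong-dual {x} {y} {a} {b} (to , from) =
    syll (ax-ex-dual1 x a) (syll (contrapose from) (ax-ex-dual2 y b)) ,
    syll (ax-ex-dual1 y b) (syll (contrapose to) (ax-ex-dual2 x a))

  α-∃ : ∀ x z φ → ¬ BindsIn x φ → ¬ Occurs z φ → z ≢ x → ex x φ ≅ ex z (Subf x z φ)
  α-∃ x z φ x-unbound z∉ z≢x =
    ∃-cong-dual (α-∀ x z (¬p φ) (λ { (bneg b) → x-unbound b }) (λ { (oneg o) → z∉ o }) z≢x)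

  unbind-≅ : ∀ x φ → φ ≅ unbind x φ
  unbind-≅ x (var v)  = ⇒-refl , ⇒-refl
  unbind-≅ x (sym s)  = ⇒-refl , ⇒-refl
  unbind-≅ x ⊥p       = ⇒-refl , ⇒-refl
  unbind-≅ x (¬p a)   = ¬-cong (unbind-≅ x a)
  unbind-≅ x (a ⇒ b)  = ⇒-cong (unbind-≅ x a) (unbind-≅ x b)
  unbind-≅ x (a ∧p b) = ∧-cong (unbind-≅ x a) (unbind-≅ x b)
  unbind-≅ x (a ∨p b) = ∨-cong (unbind-≅ x a) (unbind-≅ x b)
  unbind-≅ x (a · b)  = ·-cong (unbind-≅ x a) (unbind-≅ x b)
  unbind-≅ x (all w a) with w ≟ x
  ... | yes refl = ≅-trans (∀-cong w (unbind-≅ w a))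
                           (α-∀ w (fresh w a′) a′ (unbind-¬binds w a) (fresh-∉ w a′) (fresh-≢ w a′))
    where
    a′ : Pattern S
    a′ = unbind w a
  ... | no _     = ∀-cong w (unbind-≅ x a)
  unbind-≅ x (ex w a) with w ≟ x
  ... | yes refl = ≅-trans (∃-cong w (unbind-≅ w a))
                           (α-∃ w (fresh w a′) a′ (unbind-¬binds w a) (fresh-∉ w a′) (fresh-≢ w a′))
    where
    a′ : Pattern S
    a′ = unbind w a
  ... | no _     = ∃-cong w (unbind-≅ x a)

  ∃-elim-notFree : ∀ x φ → ¬ FreeIn x φ → ⊢ ex x φ ⇒ φ
  ∃-elim-notFree x φ nf =
    let to , from = unbind-≅ x φ in syll (∃-mono x to) (syll (∃-vacuous x _ (unbind-∉ x φ nf)) from)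

  ∀-intro-notFree : ∀ x φ → ¬ FreeIn x φ → ⊢ φ ⇒ all x φ
  ∀-intro-notFree x φ nf =
    let to , from = unbind-≅ x φ in syll to (syll (ax-vacall x _ (unbind-∉ x φ nf)) (∀-mono x from))

  ∀-inst-≢ : ∀ x y φ → x ≢ y → FreeFor x y φ → ⊢ all x φ ⇒ Subf x y φ
  ∀-inst-≢ x y φ x≢y ff =
    syll (∀⇒∃-Subf x y φ x≢y ff) (∃-elim-notFree x _ (x≢y ∘ free-Subf x y φ))

  -- ∀-inst-≢ needs two distinct variables, so pass through a fresh z:
  -- ∀x φ ⇒ ∀z ∀x φ ⇒ ∀z φ[z/x] ⇒ φ[z/x][x/z] = φ.
  ∀-elim : ∀ x φ → ⊢ all x φ ⇒ φ
  ∀-elim x φ = syll (ax-vacall z (all x φ) (∉-all z≢x z∉))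
                    (syll (∀-mono z (∀-inst-≢ x z φ (z≢x ∘ ≡.sym) (freeFor-∉ x z φ z∉))) back)
    where
    z : EVar
    z = fresh x φ
    z∉ : ¬ Occurs z φ
    z∉ = fresh-∉ x φ
    z≢x : z ≢ x
    z≢x = fresh-≢ x φ
    back : ⊢ all z (Subf x z φ) ⇒ φ
    back = subst (λ ψ → ⊢ all z (Subf x z φ) ⇒ ψ) (Subf-inverse x z φ z∉)
                 (∀-inst-≢ z x (Subf x z φ) z≢x (freeFor-Subf-inverse x z φ z∉))

  ∀-inst : ∀ x y φ → FreeFor x y φ → ⊢ all x φ ⇒ Subf x y φ
  ∀-inst x y φ ff with x ≟ y
  ... | no x≢y = ∀-inst-≢ x y φ x≢y ff
  ... | yes refl rewrite Subf-id x φ = ∀-elim x φ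

  ∃-intro : ∀ x y φ → FreeFor x y φ → ⊢ Subf x y φ ⇒ ex x φ
  ∃-intro x y φ ff = syll ¬¬-intro (syll (contrapose (∀-inst x y (¬p φ) ff)) (ax-ex-dual2 x φ))

  G⇒MG : ∀ {φ} → Γ ⊢G φ → ⊢ φ
  G⇒MG (hyp h)               = hyp h
  G⇒MG (shared a)            = shared a
  G⇒MG (mp p q)              = mp (G⇒MG p) (G⇒MG q)
  G⇒MG (syll p q)            = syll (G⇒MG p) (G⇒MG q)
  G⇒MG (exportR p)           = exportR (G⇒MG p)
  G⇒MG (importR p)           = importR (G⇒MG p)
  G⇒MG (expan χ p)           = expan χ (G⇒MG p)
  G⇒MG (frameL χ p)          = frameL χ (G⇒MG p)
  G⇒MG (frameR χ p)          = frameR χ (G⇒MG p)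
  G⇒MG (ax-ex-intro x y φ ff) = ∃-intro x y φ ff
  G⇒MG (ax-all-elim x y φ ff) = ∀-inst x y φ ff
  G⇒MG (ax-prop-botL φ)       = ·-⊥ φ
  G⇒MG (ax-prop-botR φ)       = ⊥-· φ
  G⇒MG (ex-rule {ψ = ψ} x nf p) = syll (∃-mono x (G⇒MG p)) (∃-elim-notFree x ψ nf)
  G⇒MG (all-rule {φ} x nf p)    = syll (∀-intro-notFree x φ nf) (∀-mono x (G⇒MG p))

mainTheorem2 : {S : Set} (dfd : S) (Γ : Pattern S → Set) (φ : Pattern S) →
    Γ ⊢G φ → _⊢MG_ dfd Γ φ
mainTheorem2 dfd Γ _ = MGDerivations.G⇒MG dfd Γ
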